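{- Any strictly $1$-competitive online algorithm with advice for multi-coloring paths with at least $10$ nodes has advice complexity at least $\lceil \log(\lfloor n/4 \rfloor + 1)\rceil$, where $n$ is the number of requests in the input sequence.
   Context: Online multi-coloring: a graph $G=(V,E)$ is known in advance. A sequence of $n$ requests arrives one at a time; each request names a node $v$, and must immediately and irrevocably be assigned a color (a positive integer) different from every color previously assigned to $v$ or to any neighbor of $v$. The cost $A(I)$ of an algorithm $A$ on input $I$ is the number of distinct colors used; $\mathrm{Opt}(I)$ is the minimum number of colors with which an offline algorithm can legally color all requests of $I$. Advice model: before processing, an all-powerful offline oracle that knows $I$ writes an infinite binary advice tape; the online algorithm may read bits from it at any time, and its advice complexity (on inputs of a given length $n$) is the maximum index of a bit read on such inputs. An algorithm is strictly $c$-competitive if $A(I)\le c\cdot\mathrm{Opt}(I)$ for every input $I$. All logarithms are base 2. -}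

module Defs where

open import Data.Nat using (ℕ; suc; _+_; _≤_; _<_; _≟_)
open import Data.Bool using (Bool)
open import Data.Fin using (Fin; toℕ) renaming (_<_ to _<ᶠ_)
open import Data.Vec using (Vec; lookup; toList; tabulate)
open import Data.List using (List; take; length; deduplicate)
open import Data.Sum using (_⊎_)
open import Data.Product using (∃)
open import Relation.Binary.PropositionalEquality using (_≡_; _≢_)

Adj : {m : ℕ} → Fin m → Fin m → Set
Adj u v = suc (toℕ u) ≡ toℕ v ⊎ suc (toℕ v) ≡ toℕ u

Conflict : {m : ℕ} → Fin m → Fin m → Set
Conflict u v = u ≡ v ⊎ Adj u v

Legal : {m n : ℕ} → Vec (Fin m) n → Vec ℕ n → Set
Legal {n = n} I c = (i j : Fin n) → i <ᶠ j →
  Conflict (lookup I i) (lookup I j) → lookup c i ≢ lookup c j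

numColors : {n : ℕ} → Vec ℕ n → ℕ
numColors c = length (deduplicate _≟_ (toList c))

-- Advice tape (bit with index k, 0-based, is the (k+1)-st bit).
Tape : Set
Tape = ℕ → Bool

-- An online algorithm with advice: given the advice tape and the requests
-- seen so far (ending with the current request), it outputs the color of
-- the current request.  It sees only the prefix, hence is online.
OnlineAlg : ℕ → Set
OnlineAlg m = Tape → List (Fin m) → ℕ

prefix : {m n : ℕ} → Vec (Fin m) n → Fin n → List (Fin m)
prefix I i = take (suc (toℕ i)) (toList I)

run : {m n : ℕ} → OnlineAlg m → Tape → Vec (Fin m) n → Vec ℕ n
run A φ I = tabulate (λ i → A φ (prefix I i))

AlwaysLegal : {m : ℕ} → ℕ → OnlineAlg m → Set
AlwaysLegal {m} n A = (φ : Tape) (I : Vec (Fin m) n) → Legal I (run A φ I)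

-- Advice complexity at most b on inputs of length n: A never reads a bit
-- of index > b (1-based), i.e. its behaviour on inputs of length n depends
-- only on the first b bits of the tape.
AdviceAtMost : {m : ℕ} → ℕ → ℕ → OnlineAlg m → Set
AdviceAtMost {m} n b A = (φ ψ : Tape) → (∀ k → k < b → φ k ≡ ψ k) →
  (I : Vec (Fin m) n) (i : Fin n) → A φ (prefix I i) ≡ A ψ (prefix I i)

-- Strictly 1-competitive (on inputs of length n): for every input, the
-- oracle can supply advice making A use at most Opt(I) colors, i.e. no
-- more colors than any legal offline coloring of I.
Strict1Competitive : {m : ℕ} → ℕ → OnlineAlg m → Set
Strict1Competitive {m} n A = (I : Vec (Fin m) n) → ∃ λ (φ : Tape) →
  (c : Vec ℕ n) → Legal I c → numColors (run A φ I) ≤ numColors c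

module Submission where

-- Let q = ⌊n/4⌋ (the case q = 0 is trivial) and write n = 2Q + 2q + e with
-- Q ∈ {q, q+1}, e ≤ 1.  For 0 ≤ u ≤ q the input I_u consists of blocks of
-- requests: Q at node 0 (A), Q at node 3 (D), then u at node 1 (B), u at
-- node 2 (C), and padding at the isolated nodes 5, 7, 9.  All I_u share the
-- prefix A D, and Opt(I_u) ≤ Q + u by an explicit coloring.  A counting
-- lemma on color sets shows that every legal coloring of I_u with at most
-- Q + u colors gives exactly u colors to A that D does not use.  Hence a
-- strictly 1-competitive algorithm, run with the advice chosen for I_u,
-- shows u such private colors on the common prefix; since the prefix is
-- colored online, this number is a function of the b advice bits read, so
-- q + 1 ≤ 2^b by pigeonhole.

open import Defs
open import Data.Nat using (ℕ; zero; suc; _+_; _*_; _∸_; _^_; _≤_; _<_; z≤n; s≤s; _≟_; _<?_; _/_; _%_)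
open import Data.Nat.DivMod using (m≡m%n+[m/n]*n; m%n<n; m<n⇒m/n≡0; m≥n⇒m/n>0)
open import Data.Nat.Tactic.RingSolver using (solve-∀)
open import Data.Nat.Properties
open import Data.Nat.Logarithm using (⌈log₂_⌉; ⌈log₂⌉-mono-≤; ⌈log₂2^n⌉≡n)
open import Data.Bool using (Bool; true; false)
open import Data.Fin using (Fin; zero; suc; toℕ; fromℕ<; combine; remQuot; #_)
open import Data.Fin.Properties using (pigeonhole; remQuot-combine; toℕ<n; toℕ-fromℕ<)
open import Data.Vec using (Vec; lookup; toList; tabulate)
open import Data.Vec.Properties using (lookup∘tabulate)
open import Data.List using (List; []; _∷_; length; _++_; filter; applyUpTo; upTo; take; deduplicate; foldr)
open import Data.Nat.ListAction using (sum)
import Data.List as List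
open import Data.List.Properties using (length-++; length-removeAt′; length-applyUpTo)
open import Data.List.Relation.Unary.Any using (here; there; index; _─_)
open import Data.List.Relation.Unary.All using (All)
import Data.List.Relation.Unary.All as All
open import Data.List.Relation.Unary.AllPairs using ([]; _∷_)
open import Data.List.Membership.Propositional using (_∈_)
open import Data.List.Membership.Propositional.Properties
  using (∈-filter⁺; ∈-filter⁻; ∈-++⁻; ∈-applyUpTo⁻; ∈-tabulate⁺; ∈-tabulate⁻; ∈-deduplicate⁺; ∈-deduplicate⁻; ∈-upTo⁺)
open import Data.List.Relation.Unary.Unique.DecPropositional.Properties using (deduplicate-!)
open import Data.List.Membership.DecPropositional _≟_ using (_∈?_; _∉?_)
open import Data.List.Relation.Binary.Subset.Propositional using (_⊆_)
open import Data.List.Relation.Binary.Disjoint.Propositional using (Disjoint)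
open import Data.List.Relation.Unary.Unique.Propositional using (Unique)
import Data.List.Relation.Unary.Unique.Propositional.Properties as Unique
open import Data.Empty using (⊥; ⊥-elim)
open import Data.Sum using (_⊎_; inj₁; inj₂)
open import Data.Product using (Σ; ∃; _×_; _,_; proj₁; proj₂)
open import Function using (_∘_)
open import Relation.Nullary using (yes; no)
open import Relation.Binary.PropositionalEquality

∈-─⁺ : {A : Set} {x z : A} {ys : List A} (x∈ys : x ∈ ys) → z ∈ ys → z ≢ x → z ∈ (ys ─ x∈ys)
∈-─⁺ (here refl) (here refl) z≢x = ⊥-elim (z≢x refl)
∈-─⁺ (here refl) (there z∈ys) _ = z∈ys
∈-─⁺ (there _) (here refl) _ = here refl
∈-─⁺ (there x∈ys) (there z∈ys) z≢x = there (∈-─⁺ x∈ys z∈ys z≢x)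

unique-⊆⇒length≤ : {A : Set} {xs ys : List A} → Unique xs → xs ⊆ ys → length xs ≤ length ys
unique-⊆⇒length≤ {xs = []} [] _ = z≤n
unique-⊆⇒length≤ {xs = x ∷ xs} {ys} (x∉xs ∷ unique) xs⊆ys = begin
  suc (length xs)             ≤⟨ s≤s (unique-⊆⇒length≤ unique xs⊆ys─x) ⟩
  suc (length (ys ─ x∈ys))    ≡⟨ length-removeAt′ ys (index x∈ys) ⟨
  length ys                   ∎
  where
  open ≤-Reasoning
  x∈ys : x ∈ ys
  x∈ys = xs⊆ys (here refl)
  xs⊆ys─x : xs ⊆ (ys ─ x∈ys)
  xs⊆ys─x z∈xs = ∈-─⁺ x∈ys (xs⊆ys (there z∈xs)) (λ z≡x → All.lookup x∉xs z∈xs (sym z≡x))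

_∖_ : List ℕ → List ℕ → List ℕ
xs ∖ ys = filter (_∉? ys) xs

∖-⊆ : (xs ys : List ℕ) → xs ∖ ys ⊆ xs
∖-⊆ xs ys z∈xs∖ys = proj₁ (∈-filter⁻ (_∉? ys) {xs = xs} z∈xs∖ys)

∖-disjoint : (xs ys : List ℕ) → Disjoint (xs ∖ ys) ys
∖-disjoint xs ys (z∈xs∖ys , z∈ys) = proj₂ (∈-filter⁻ (_∉? ys) {xs = xs} z∈xs∖ys) z∈ys

-- SA, SB, SC, SD are the color sets of four groups
-- of requests at the consecutive path nodes 0, 1, 2, 3 (so each is duplicate
-- free and consecutive ones are disjoint), |SA| = |SD| = Q, |SB| = |SC| = u,
-- and all colors come from a palette P of at most Q + u colors.

private-colors-upper : {SA SD P : List ℕ} → Unique SA → Unique SD → SA ⊆ P → SD ⊆ P →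
  length (SA ∖ SD) + length SD ≤ length P
private-colors-upper {SA} {SD} {P} uA uD SA⊆P SD⊆P = begin
  length (SA ∖ SD) + length SD  ≡⟨ length-++ (SA ∖ SD) ⟨
  length ((SA ∖ SD) ++ SD)      ≤⟨ unique-⊆⇒length≤ unique ⊆P ⟩
  length P                      ∎
  where
  open ≤-Reasoning
  unique : Unique ((SA ∖ SD) ++ SD)
  unique = Unique.++⁺ (Unique.filter⁺ (_∉? SD) uA) uD (∖-disjoint SA SD)
  ⊆P : (SA ∖ SD) ++ SD ⊆ P
  ⊆P z∈ with ∈-++⁻ (SA ∖ SD) z∈
  ... | inj₁ z∈SA∖SD = SA⊆P (∖-⊆ SA SD z∈SA∖SD)
  ... | inj₂ z∈SD = SD⊆P z∈SD

no-room-beyond : {SA SB SC P : List ℕ} → Unique SA → Unique SB → Disjoint SA SB →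
  Disjoint SB SC → SA ⊆ P → SB ⊆ P → SC ⊆ P → length P ≤ length SA + length SB → SC ⊆ SA
no-room-beyond {SA} {SB} {SC} {P} uA uB dAB dBC SA⊆P SB⊆P SC⊆P small {x} x∈SC with x ∈? SA
... | yes x∈SA = x∈SA
... | no x∉SA = ⊥-elim (<⇒≱ too-many small)
  where
  open ≤-Reasoning
  x∉SB++SA : All (x ≢_) (SB ++ SA)
  x∉SB++SA = All.tabulate λ z∈ x≡z → case (∈-++⁻ SB z∈) x≡z
    where
    case : ∀ {z} → z ∈ SB ⊎ z ∈ SA → x ≡ z → ⊥
    case (inj₁ z∈SB) refl = dBC (z∈SB , x∈SC)
    case (inj₂ z∈SA) refl = x∉SA z∈SA
  unique : Unique (x ∷ SB ++ SA)
  unique = x∉SB++SA ∷ Unique.++⁺ uB uA (λ (z∈SB , z∈SA) → dAB (z∈SA , z∈SB))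
  ⊆P : x ∷ SB ++ SA ⊆ P
  ⊆P (here refl) = SC⊆P x∈SC
  ⊆P (there z∈) with ∈-++⁻ SB z∈
  ... | inj₁ z∈SB = SB⊆P z∈SB
  ... | inj₂ z∈SA = SA⊆P z∈SA
  too-many : length SA + length SB < length P
  too-many = begin-strict
    length SA + length SB        ≡⟨ +-comm (length SA) (length SB) ⟩
    length SB + length SA        ≡⟨ length-++ SB ⟨
    length (SB ++ SA)            <⟨ n<1+n _ ⟩
    length (x ∷ SB ++ SA)        ≤⟨ unique-⊆⇒length≤ unique ⊆P ⟩
    length P                     ∎

private-colors-lower : {SA SC SD : List ℕ} → Unique SC → SC ⊆ SA → Disjoint SC SD →
  length SC ≤ length (SA ∖ SD)
private-colors-lower {SA} {SC} {SD} uC SC⊆SA dCD = unique-⊆⇒length≤ uC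
  (λ z∈SC → ∈-filter⁺ (_∉? SD) (SC⊆SA z∈SC) (λ z∈SD → dCD (z∈SC , z∈SD)))

private-colors-exact : {Q u : ℕ} {SA SB SC SD P : List ℕ} →
  Unique SA → Unique SB → Unique SC → Unique SD →
  length SA ≡ Q → length SB ≡ u → length SC ≡ u → length SD ≡ Q →
  Disjoint SA SB → Disjoint SB SC → Disjoint SC SD →
  SA ⊆ P → SB ⊆ P → SC ⊆ P → SD ⊆ P → length P ≤ Q + u →
  length (SA ∖ SD) ≡ u
private-colors-exact {Q} {u} {SA} {SB} {SC} {SD} {P}
  uA uB uC uD |SA|≡Q |SB|≡u |SC|≡u |SD|≡Q dAB dBC dCD SA⊆P SB⊆P SC⊆P SD⊆P small =
  ≤-antisym (+-cancelʳ-≤ Q (length (SA ∖ SD)) u upper) lower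
  where
  open ≤-Reasoning
  upper : length (SA ∖ SD) + Q ≤ u + Q
  upper = begin
    length (SA ∖ SD) + Q           ≡⟨ cong (length (SA ∖ SD) +_) |SD|≡Q ⟨
    length (SA ∖ SD) + length SD   ≤⟨ private-colors-upper uA uD SA⊆P SD⊆P ⟩
    length P                       ≤⟨ small ⟩
    Q + u                          ≡⟨ +-comm Q u ⟩
    u + Q                          ∎
  no-room : length P ≤ length SA + length SB
  no-room = ≤-trans small (≤-reflexive (sym (cong₂ _+_ |SA|≡Q |SB|≡u)))
  lower : u ≤ length (SA ∖ SD)
  lower = subst (_≤ length (SA ∖ SD)) |SC|≡u
    (private-colors-lower uC (no-room-beyond uA uB dAB dBC SA⊆P SB⊆P SC⊆P no-room) dCD)

_≈[_]_ : Tape → ℕ → Tape → Set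
φ ≈[ b ] ψ = ∀ k → k < b → φ k ≡ ψ k

bit : Bool → Fin 2
bit false = zero
bit true = suc zero

bit-injective : ∀ {x y} → bit x ≡ bit y → x ≡ y
bit-injective {false} {false} _ = refl
bit-injective {true} {true} _ = refl

prefixCode : Tape → (b : ℕ) → Fin (2 ^ b)
prefixCode φ zero = zero
prefixCode φ (suc b) = combine (bit (φ 0)) (prefixCode (φ ∘ suc) b)

combine-injective : ∀ {m n} (i k : Fin m) (j l : Fin n) → combine i j ≡ combine k l → i ≡ k × j ≡ l
combine-injective {n = n} i k j l same = split (trans (sym (remQuot-combine i j))
                                                 (trans (cong (remQuot n) same) (remQuot-combine k l)))
  where
  split : (i , j) ≡ (k , l) → i ≡ k × j ≡ l
  split refl = refl , refl

prefixCode-injective : ∀ b (φ ψ : Tape) → prefixCode φ b ≡ prefixCode ψ b → φ ≈[ b ] ψ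
prefixCode-injective (suc b) φ ψ same zero _ =
  bit-injective (proj₁ (combine-injective (bit (φ 0)) (bit (ψ 0)) _ _ same))
prefixCode-injective (suc b) φ ψ same (suc k) (s≤s k<b) =
  prefixCode-injective b (φ ∘ suc) (ψ ∘ suc) (proj₂ (combine-injective (bit (φ 0)) (bit (ψ 0)) _ _ same)) k k<b

few-values : (b q : ℕ) (f : Tape → ℕ) (φ : ℕ → Tape) →
  (∀ ψ χ → ψ ≈[ b ] χ → f ψ ≡ f χ) → (∀ u → u ≤ q → f (φ u) ≡ u) → suc q ≤ 2 ^ b
few-values b q f φ local realizes with 2 ^ b <? suc q
... | no not-small = ≮⇒≥ not-small
... | yes small with pigeonhole small (λ i → prefixCode (φ (toℕ i)) b)
... | i , j , i<j , same-code = ⊥-elim (<⇒≢ i<j (begin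
  toℕ i            ≡⟨ realizes (toℕ i) (≤-pred (toℕ<n i)) ⟨
  f (φ (toℕ i))    ≡⟨ local _ _ (prefixCode-injective b _ _ same-code) ⟩
  f (φ (toℕ j))    ≡⟨ realizes (toℕ j) (≤-pred (toℕ<n j)) ⟩
  toℕ j            ∎))
  where open ≡-Reasoning

⌈log₂⌉-≤ : ∀ b k → k ≤ 2 ^ b → ⌈log₂ k ⌉ ≤ b
⌈log₂⌉-≤ b k k≤2^b = subst (⌈log₂ k ⌉ ≤_) (⌈log₂2^n⌉≡n b) (⌈log₂⌉-mono-≤ k≤2^b)

-- Inputs and colorings are handled as sequences ℕ → _, of which the first n
-- entries are used.
tabulateℕ : {A : Set} (n : ℕ) → (ℕ → A) → Vec A n
tabulateℕ n f = tabulate (f ∘ toℕ)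

toList-tabulate : {A : Set} {n : ℕ} (f : Fin n → A) → toList (tabulate f) ≡ List.tabulate f
toList-tabulate {n = zero} f = refl
toList-tabulate {n = suc n} f = cong (f zero ∷_) (toList-tabulate (f ∘ suc))

∈-tabulateℕ⁺ : {A : Set} {n j : ℕ} (f : ℕ → A) → j < n → f j ∈ toList (tabulateℕ n f)
∈-tabulateℕ⁺ {n = n} f j<n rewrite toList-tabulate {n = n} (f ∘ toℕ) =
  subst (λ k → f k ∈ List.tabulate (f ∘ toℕ)) (toℕ-fromℕ< j<n) (∈-tabulate⁺ (fromℕ< j<n))

∈-tabulateℕ⁻ : {A : Set} {n : ℕ} {z : A} (f : ℕ → A) → z ∈ toList (tabulateℕ n f) →
  Σ ℕ λ j → j < n × z ≡ f j
∈-tabulateℕ⁻ {n = n} f z∈ rewrite toList-tabulate {n = n} (f ∘ toℕ) =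
  let (i , z≡) = ∈-tabulate⁻ z∈ in toℕ i , toℕ<n i , z≡

LegalSeq : {m : ℕ} (n : ℕ) → (ℕ → Fin m) → (ℕ → ℕ) → Set
LegalSeq n req col = ∀ x y → x < y → y < n → Conflict (req x) (req y) → col x ≢ col y

legal⁻ : {m n : ℕ} (req : ℕ → Fin m) (col : ℕ → ℕ) →
  Legal (tabulateℕ n req) (tabulateℕ n col) → LegalSeq n req col
legal⁻ {n = n} req col legal x y x<y y<n conflict same =
  legal (fromℕ< x<n) (fromℕ< y<n) (subst₂ _<_ (sym (toℕ-fromℕ< x<n)) (sym (toℕ-fromℕ< y<n)) x<y)
    (subst₂ Conflict (entry req x<n) (entry req y<n) conflict)
    (trans (sym (entry col x<n)) (trans same (entry col y<n)))
  where
  x<n : x < n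
  x<n = <-trans x<y y<n
  entry : {A : Set} {j : ℕ} (f : ℕ → A) (j<n : j < n) → f j ≡ lookup (tabulateℕ n f) (fromℕ< j<n)
  entry f j<n = trans (cong f (sym (toℕ-fromℕ< j<n))) (sym (lookup∘tabulate (f ∘ toℕ) (fromℕ< j<n)))

legal⁺ : {m n : ℕ} (req : ℕ → Fin m) (col : ℕ → ℕ) →
  LegalSeq n req col → Legal (tabulateℕ n req) (tabulateℕ n col)
legal⁺ req col legal i j i<j conflict same =
  legal (toℕ i) (toℕ j) i<j (toℕ<n j)
    (subst₂ Conflict (lookup∘tabulate (req ∘ toℕ) i) (lookup∘tabulate (req ∘ toℕ) j) conflict)
    (trans (sym (lookup∘tabulate (col ∘ toℕ) i)) (trans same (lookup∘tabulate (col ∘ toℕ) j)))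

usedColors : (n : ℕ) → (ℕ → ℕ) → List ℕ
usedColors n col = deduplicate _≟_ (toList (tabulateℕ n col))

∈-usedColors : {n j : ℕ} (col : ℕ → ℕ) → j < n → col j ∈ usedColors n col
∈-usedColors col j<n = ∈-deduplicate⁺ _≟_ (∈-tabulateℕ⁺ col j<n)

numColors-≤ : (n : ℕ) (col : ℕ → ℕ) (K : ℕ) → (∀ j → j < n → col j < K) → numColors (tabulateℕ n col) ≤ K
numColors-≤ n col K below = subst (numColors (tabulateℕ n col) ≤_) (length-applyUpTo (λ k → k) K)
  (unique-⊆⇒length≤ (deduplicate-! _≟_ (toList (tabulateℕ n col))) ⊆upTo)
  where
  ⊆upTo : usedColors n col ⊆ upTo K
  ⊆upTo z∈ with ∈-tabulateℕ⁻ col (∈-deduplicate⁻ _≟_ (toList (tabulateℕ n col)) z∈)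
  ... | j , j<n , refl = ∈-upTo⁺ (below j j<n)

onlineColoring : {m n : ℕ} → OnlineAlg m → Tape → Vec (Fin m) n → ℕ → ℕ
onlineColoring alg φ I j = alg φ (take (suc j) (toList I))

take-tabulate : {A : Set} {n : ℕ} (f g : Fin n → A) (k : ℕ) → (∀ i → toℕ i < k → f i ≡ g i) →
  take k (toList (tabulate f)) ≡ take k (toList (tabulate g))
take-tabulate {n = zero} f g k agree = refl
take-tabulate {n = suc n} f g zero agree = refl
take-tabulate {n = suc n} f g (suc k) agree = cong₂ _∷_ (agree zero (s≤s z≤n))
  (take-tabulate (f ∘ suc) (g ∘ suc) k (λ i i<k → agree (suc i) (s≤s i<k)))

onlineColoring-prefix : {m n j : ℕ} (alg : OnlineAlg m) (φ : Tape) (req req′ : ℕ → Fin m) →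
  (∀ k → k ≤ j → req k ≡ req′ k) →
  onlineColoring alg φ (tabulateℕ n req) j ≡ onlineColoring alg φ (tabulateℕ n req′) j
onlineColoring-prefix {j = j} alg φ req req′ agree =
  cong (alg φ) (take-tabulate (req ∘ toℕ) (req′ ∘ toℕ) (suc j) (λ i i≤j → agree (toℕ i) (≤-pred i≤j)))

onlineColoring-local : {m n b : ℕ} {alg : OnlineAlg m} → AdviceAtMost n b alg →
  ∀ {φ ψ} → φ ≈[ b ] ψ → (I : Vec (Fin m) n) → ∀ {j} → j < n →
  onlineColoring alg φ I j ≡ onlineColoring alg ψ I j
onlineColoring-local {alg = alg} few-bits {φ} {ψ} φ≈ψ I j<n =
  subst (λ k → onlineColoring alg φ I k ≡ onlineColoring alg ψ I k) (toℕ-fromℕ< j<n)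
    (few-bits φ ψ φ≈ψ I (fromℕ< j<n))

record RequestGroup {m : ℕ} (n : ℕ) (req : ℕ → Fin m) (v : Fin m) : Set where
  field
    size : ℕ
    pos : ℕ → ℕ
    increasing : ∀ {i i′} → i < i′ → pos i < pos i′
    inside : ∀ {i} → i < size → pos i < n
    atNode : ∀ {i} → i < size → req (pos i) ≡ v

module _ {m n : ℕ} {req : ℕ → Fin m} {v : Fin m} where
  open RequestGroup

  groupColors : RequestGroup n req v → (ℕ → ℕ) → List ℕ
  groupColors G col = applyUpTo (col ∘ pos G) (size G)

  groupColors-⊆ : (G : RequestGroup n req v) (col : ℕ → ℕ) → groupColors G col ⊆ usedColors n col
  groupColors-⊆ G col z∈ with ∈-applyUpTo⁻ (col ∘ pos G) z∈
  ... | i , i<size , refl = ∈-usedColors col (inside G i<size)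

module _ {m n : ℕ} {req : ℕ → Fin m} {col : ℕ → ℕ} (legal : LegalSeq n req col) where
  open RequestGroup

  groupColors-unique : {v : Fin m} (G : RequestGroup n req v) → Unique (groupColors G col)
  groupColors-unique G = Unique.applyUpTo⁺₁ (col ∘ pos G) (size G) λ i<i′ i′<size →
    legal _ _ (increasing G i<i′) (inside G i′<size)
      (inj₁ (trans (atNode G (<-trans i<i′ i′<size)) (sym (atNode G i′<size))))

  groupColors-disjoint : {v v′ : Fin m} (G : RequestGroup n req v) (G′ : RequestGroup n req v′) →
    Conflict v v′ → (∀ {i i′} → i < size G → i′ < size G′ → pos G i < pos G′ i′) →
    Disjoint (groupColors G col) (groupColors G′ col)
  groupColors-disjoint G G′ conflict before (z∈G , z∈G′)
    with ∈-applyUpTo⁻ (col ∘ pos G) z∈G | ∈-applyUpTo⁻ (col ∘ pos G′) z∈G′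
  ... | i , i<size , refl | i′ , i′<size′ , same =
    legal _ _ (before i<size i′<size′) (inside G′ i′<size′)
      (subst₂ Conflict (sym (atNode G i<size)) (sym (atNode G′ i′<size′)) conflict) same

-- It is opaque, so that it is used only through the two
-- lemmas below, whose implicit arguments are then found by unification.
opaque
  prepend : {A : Set} → ℕ → (ℕ → A) → (ℕ → A) → ℕ → A
  prepend L f r j with j <? L
  ... | yes _ = f j
  ... | no _ = r (j ∸ L)

  prepend-head : {A : Set} {L j : ℕ} {f r : ℕ → A} → j < L → prepend L f r j ≡ f j
  prepend-head {L = L} {j} j<L with j <? L
  ... | yes _ = refl
  ... | no j≮L = ⊥-elim (j≮L j<L)

  prepend-tail : {A : Set} {L k : ℕ} {f r : ℕ → A} {y : A} → r k ≡ y → prepend L f r (L + k) ≡ y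
  prepend-tail {L = L} {k} {r = r} rk≡y with L + k <? L
  ... | yes L+k<L = ⊥-elim (<⇒≱ L+k<L (m≤m+n L k))
  ... | no _ = trans (cong r (m+n∸m≡n L k)) rk≡y

split : (L j : ℕ) → j < L ⊎ ∃ λ k → j ≡ L + k
split L j with j <? L
... | yes j<L = inj₁ j<L
... | no j≮L = inj₂ (j ∸ L , sym (m+[n∸m]≡n (≮⇒≥ j≮L)))

prepend-agree : {A : Set} {L ℓ : ℕ} {f r r′ : ℕ → A} → (∀ k → k < ℓ → r k ≡ r′ k) →
  ∀ j → j < L + ℓ → prepend L f r j ≡ prepend L f r′ j
prepend-agree {L = L} {f = f} {r} {r′} agree j j<L+ℓ with split L j
... | inj₁ j<L = trans (prepend-head {r = r} j<L) (sym (prepend-head {r = r′} j<L))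
... | inj₂ (k , refl) = trans (prepend-tail {L = L} {f = f} (agree k (+-cancelˡ-< L k _ j<L+ℓ)))
                               (sym (prepend-tail {L = L} {f = f} refl))

-- `offset xs i = x₁ + (x₂ + (… + i))`: position i of a block that is preceded
-- by blocks of the lengths xs.
offset : List ℕ → ℕ → ℕ
offset xs i = foldr _+_ i xs

offset-monoʳ-< : (xs : List ℕ) {i j : ℕ} → i < j → offset xs i < offset xs j
offset-monoʳ-< [] i<j = i<j
offset-monoʳ-< (x ∷ xs) i<j = +-monoʳ-< x (offset-monoʳ-< xs i<j)

offset-cancelʳ-< : (xs : List ℕ) {i j : ℕ} → offset xs i < offset xs j → i < j
offset-cancelʳ-< [] i<j = i<j
offset-cancelʳ-< (x ∷ xs) lt = offset-cancelʳ-< xs (+-cancelˡ-< x _ _ lt)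

offset-before : (xs ys : List ℕ) {y i : ℕ} (j : ℕ) → i < y → offset xs i < offset (xs ++ y ∷ ys) j
offset-before [] ys {y} j i<y = <-≤-trans i<y (m≤m+n y _)
offset-before (x ∷ xs) ys j i<y = +-monoʳ-< x (offset-before xs ys j i<y)

-- The colors given by `col` to the first Q requests but not to the next Q;
-- in the hard instances these are the colors of block A unused by block D.
privateColors : ℕ → (ℕ → ℕ) → List ℕ
privateColors Q col = applyUpTo col Q ∖ applyUpTo (λ i → col (Q + i)) Q

applyUpTo-cong : {A : Set} (f g : ℕ → A) (n : ℕ) → (∀ i → i < n → f i ≡ g i) → applyUpTo f n ≡ applyUpTo g n
applyUpTo-cong f g zero agree = refl
applyUpTo-cong f g (suc n) agree = cong₂ _∷_ (agree 0 (s≤s z≤n))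
  (applyUpTo-cong (f ∘ suc) (g ∘ suc) n (λ i i<n → agree (suc i) (s≤s i<n)))

privateColors-cong : (Q : ℕ) (col col′ : ℕ → ℕ) → (∀ j → j < Q + Q → col j ≡ col′ j) →
  privateColors Q col ≡ privateColors Q col′
privateColors-cong Q col col′ agree = cong₂ _∖_
  (applyUpTo-cong col col′ Q (λ i i<Q → agree i (<-≤-trans i<Q (m≤m+n Q Q))))
  (applyUpTo-cong _ _ Q (λ i i<Q → agree (Q + i) (+-monoʳ-< Q i<Q)))

-- The hard instances use seven blocks of requests; a block is indexed by the
-- path node all its requests name.  Blocks A, B, C, D sit on the consecutive
-- nodes 0–3; the padding blocks on the isolated nodes 5, 7, 9 only fill the
-- input up to its prescribed length.
data Block : ℕ → Set where
  blockA : Block 0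
  blockB : Block 1
  blockC : Block 2
  blockD : Block 3
  pad₅ : Block 5
  pad₇ : Block 7
  pad₉ : Block 9

block-unique : {p : ℕ} (β β′ : Block p) → β ≡ β′
block-unique blockA blockA = refl
block-unique blockB blockB = refl
block-unique blockC blockC = refl
block-unique blockD blockD = refl
block-unique pad₅ pad₅ = refl
block-unique pad₇ pad₇ = refl
block-unique pad₉ pad₉ = refl

conflict-nodes : {m : ℕ} {x y : Fin m} → Conflict x y →
  toℕ x ≡ toℕ y ⊎ suc (toℕ x) ≡ toℕ y ⊎ suc (toℕ y) ≡ toℕ x
conflict-nodes (inj₁ refl) = inj₁ refl
conflict-nodes (inj₂ adjacent) = inj₂ adjacent

module Instance (m′ Q u w e : ℕ) where

  -- The path has at least ten nodes, so every block index is a node.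
  node : {p : ℕ} → Block p → Fin (10 + m′)
  node blockA = # 0
  node blockB = # 1
  node blockC = # 2
  node blockD = # 3
  node pad₅ = # 5
  node pad₇ = # 7
  node pad₉ = # 9

  toℕ-node : {p : ℕ} (β : Block p) → toℕ (node β) ≡ p
  toℕ-node blockA = refl
  toℕ-node blockB = refl
  toℕ-node blockC = refl
  toℕ-node blockD = refl
  toℕ-node pad₅ = refl
  toℕ-node pad₇ = refl
  toℕ-node pad₉ = refl

  size : {p : ℕ} → Block p → ℕ
  size blockA = Q
  size blockD = Q
  size blockB = u
  size blockC = u
  size pad₅ = w
  size pad₇ = w
  size pad₉ = e

  sizes : List ℕ
  sizes = Q ∷ Q ∷ u ∷ u ∷ w ∷ w ∷ e ∷ []

  total : ℕ
  total = sum sizes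

  before after : {p : ℕ} → Block p → List ℕ
  before blockA = []
  before blockD = Q ∷ []
  before blockB = Q ∷ Q ∷ []
  before blockC = Q ∷ Q ∷ u ∷ []
  before pad₅ = Q ∷ Q ∷ u ∷ u ∷ []
  before pad₇ = Q ∷ Q ∷ u ∷ u ∷ w ∷ []
  before pad₉ = Q ∷ Q ∷ u ∷ u ∷ w ∷ w ∷ []
  after blockA = Q ∷ u ∷ u ∷ w ∷ w ∷ e ∷ []
  after blockD = u ∷ u ∷ w ∷ w ∷ e ∷ []
  after blockB = u ∷ w ∷ w ∷ e ∷ []
  after blockC = w ∷ w ∷ e ∷ []
  after pad₅ = w ∷ e ∷ []
  after pad₇ = e ∷ []
  after pad₉ = []

  sizes-split : {p : ℕ} (β : Block p) → before β ++ size β ∷ after β ≡ sizes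
  sizes-split blockA = refl
  sizes-split blockD = refl
  sizes-split blockB = refl
  sizes-split blockC = refl
  sizes-split pad₅ = refl
  sizes-split pad₇ = refl
  sizes-split pad₉ = refl

  pos : {p : ℕ} → Block p → ℕ → ℕ
  pos β = offset (before β)

  pos-bound : {p i : ℕ} (β : Block p) → i < size β → pos β i < total
  pos-bound β i<size = subst (pos β _ <_) (cong (λ xs → offset xs 0) (sizes-split β))
    (offset-before (before β) (after β) 0 i<size)

  layout : {X : Set} → (∀ {p} → Block p → ℕ → X) → ℕ → X
  layout f = prepend Q (f blockA) (prepend Q (f blockD) (prepend u (f blockB) (prepend u (f blockC)
               (prepend w (f pad₅) (prepend w (f pad₇) (f pad₉))))))

  layout-at : {X : Set} (f : ∀ {p} → Block p → ℕ → X) {p i : ℕ} (β : Block p) → i < size β →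
    layout f (pos β i) ≡ f β i
  layout-at f blockA i<size = prepend-head i<size
  layout-at f blockD i<size = prepend-tail (prepend-head i<size)
  layout-at f blockB i<size = prepend-tail (prepend-tail (prepend-head i<size))
  layout-at f blockC i<size = prepend-tail (prepend-tail (prepend-tail (prepend-head i<size)))
  layout-at f pad₅ i<size = prepend-tail (prepend-tail (prepend-tail (prepend-tail (prepend-head i<size))))
  layout-at f pad₇ i<size =
    prepend-tail (prepend-tail (prepend-tail (prepend-tail (prepend-tail (prepend-head i<size)))))
  layout-at f pad₉ _ = prepend-tail (prepend-tail (prepend-tail (prepend-tail (prepend-tail (prepend-tail refl)))))

  Located : ℕ → Set
  Located j = Σ ℕ λ p → Σ (Block p) λ β → Σ ℕ λ i → i < size β × j ≡ pos β i

  locate : (j : ℕ) → j < total → Located j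
  locate j j<n with split Q j
  ... | inj₁ j<Q = _ , blockA , j , j<Q , refl
  ... | inj₂ (j₁ , refl) with split Q j₁
  ... | inj₁ j₁<Q = _ , blockD , j₁ , j₁<Q , refl
  ... | inj₂ (j₂ , refl) with split u j₂
  ... | inj₁ j₂<u = _ , blockB , j₂ , j₂<u , refl
  ... | inj₂ (j₃ , refl) with split u j₃
  ... | inj₁ j₃<u = _ , blockC , j₃ , j₃<u , refl
  ... | inj₂ (j₄ , refl) with split w j₄
  ... | inj₁ j₄<w = _ , pad₅ , j₄ , j₄<w , refl
  ... | inj₂ (j₅ , refl) with split w j₅
  ... | inj₁ j₅<w = _ , pad₇ , j₅ , j₅<w , refl
  ... | inj₂ (j₆ , refl) =
    _ , pad₉ , j₆ , subst (j₆ <_) (+-identityʳ e) (offset-cancelʳ-< (before pad₉) j<n) , refl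

  request : ℕ → Fin (10 + m′)
  request = layout (λ β _ → node β)

  group : {p : ℕ} (β : Block p) → RequestGroup total request (node β)
  group β = record
    { size = size β
    ; pos = pos β
    ; increasing = offset-monoʳ-< (before β)
    ; inside = pos-bound β
    ; atNode = layout-at (λ β′ _ → node β′) β
    }

  -- An offline coloring with Q + u colors: block β receives the colors
  -- firstColor β, …, colorEnd β - 1.  Blocks A and D share no colors, while C
  -- reuses those of A not shared with B.
  firstColor : {p : ℕ} → Block p → ℕ
  firstColor blockA = u
  firstColor blockC = Q
  firstColor _ = 0

  colorEnd : {p : ℕ} → Block p → ℕ
  colorEnd β = firstColor β + size β

  offline : ℕ → ℕ
  offline = layout (λ β i → firstColor β + i)

  offline-at : {p i : ℕ} (β : Block p) → i < size β → offline (pos β i) ≡ firstColor β + i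
  offline-at = layout-at (λ β i → firstColor β + i)

  Separated : {p p′ : ℕ} → Block p → Block p′ → Set
  Separated β β′ = colorEnd β ≤ firstColor β′ ⊎ colorEnd β′ ≤ firstColor β

  separated-distinct : {p p′ i i′ : ℕ} (β : Block p) (β′ : Block p′) → Separated β β′ →
    i < size β → i′ < size β′ → firstColor β + i ≢ firstColor β′ + i′
  separated-distinct β β′ (inj₁ end≤first′) i<size _ same =
    <⇒≱ (<-≤-trans (+-monoʳ-< (firstColor β) i<size) end≤first′) (≤-trans (m≤m+n _ _) (≤-reflexive (sym same)))
  separated-distinct β β′ (inj₂ end′≤first) _ i′<size′ same =
    <⇒≱ (<-≤-trans (+-monoʳ-< (firstColor β′) i′<size′) end′≤first) (≤-trans (m≤m+n _ _) (≤-reflexive same))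

  adjacent-separated : u ≤ Q → {p : ℕ} (β : Block p) (β′ : Block (suc p)) → Separated β β′
  adjacent-separated _ blockA blockB = inj₂ ≤-refl
  adjacent-separated u≤Q blockB blockC = inj₁ u≤Q
  adjacent-separated _ blockC blockD = inj₂ ≤-refl
  adjacent-separated _ blockD ()
  adjacent-separated _ pad₅ ()
  adjacent-separated _ pad₇ ()
  adjacent-separated _ pad₉ ()

  offline-same-request : u ≤ Q → {p p′ i i′ : ℕ} (β : Block p) (β′ : Block p′) →
    i < size β → i′ < size β′ → Conflict (node β) (node β′) →
    firstColor β + i ≡ firstColor β′ + i′ → pos β i ≡ pos β′ i′
  offline-same-request u≤Q {p} {p′} β β′ i<size i′<size′ conflict same
    with subst₂ (λ a b → a ≡ b ⊎ suc a ≡ b ⊎ suc b ≡ a) (toℕ-node β) (toℕ-node β′) (conflict-nodes conflict)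
  ... | inj₁ refl with block-unique β β′
  ... | refl = cong (pos β) (+-cancelˡ-≡ (firstColor β) _ _ same)
  offline-same-request u≤Q β β′ i<size i′<size′ conflict same | inj₂ (inj₁ refl) =
    ⊥-elim (separated-distinct β β′ (adjacent-separated u≤Q β β′) i<size i′<size′ same)
  offline-same-request u≤Q β β′ i<size i′<size′ conflict same | inj₂ (inj₂ refl) =
    ⊥-elim (separated-distinct β′ β (adjacent-separated u≤Q β′ β) i′<size′ i<size (sym same))

  offline-legal : u ≤ Q → LegalSeq total request offline
  offline-legal u≤Q x y x<y y<n conflict same
    with locate x (<-trans x<y y<n) | locate y y<n
  ... | _ , β , i , i<size , refl | _ , β′ , i′ , i′<size′ , refl =
    <-irrefl (offline-same-request u≤Q β β′ i<size i′<size′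
               (subst₂ Conflict (layout-at (λ β _ → node β) β i<size) (layout-at (λ β _ → node β) β′ i′<size′) conflict)
               (trans (sym (offline-at β i<size)) (trans same (offline-at β′ i′<size′))))
             x<y

  colorEnd-bound : w ≤ Q → e ≤ 1 → 1 ≤ Q → {p : ℕ} (β : Block p) → colorEnd β ≤ Q + u
  colorEnd-bound _ _ _ blockA = ≤-reflexive (+-comm u Q)
  colorEnd-bound _ _ _ blockB = m≤n+m u Q
  colorEnd-bound _ _ _ blockC = ≤-refl
  colorEnd-bound _ _ _ blockD = m≤m+n Q u
  colorEnd-bound w≤Q _ _ pad₅ = ≤-trans w≤Q (m≤m+n Q u)
  colorEnd-bound w≤Q _ _ pad₇ = ≤-trans w≤Q (m≤m+n Q u)
  colorEnd-bound _ e≤1 1≤Q pad₉ = ≤-trans e≤1 (≤-trans 1≤Q (m≤m+n Q u))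

  offline-colors : w ≤ Q → e ≤ 1 → 1 ≤ Q → numColors (tabulateℕ total offline) ≤ Q + u
  offline-colors w≤Q e≤1 1≤Q = numColors-≤ total offline (Q + u) below
    where
    below : ∀ j → j < total → offline j < Q + u
    below j j<n with locate j j<n
    ... | _ , β , i , i<size , refl = subst (_< Q + u) (sym (offline-at β i<size))
      (<-≤-trans (+-monoʳ-< (firstColor β) i<size) (colorEnd-bound w≤Q e≤1 1≤Q β))

  optimal-private : {n : ℕ} → n ≡ total → (col : ℕ → ℕ) → LegalSeq n request col →
    numColors (tabulateℕ n col) ≤ Q + u → length (privateColors Q col) ≡ u
  optimal-private refl col legal few =
    private-colors-exact (unique blockA) (unique blockB) (unique blockC) (unique blockD)
      (length-applyUpTo _ Q) (length-applyUpTo _ u) (length-applyUpTo _ u) (length-applyUpTo _ Q)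
      (groupColors-disjoint legal (group blockA) (group blockB) (inj₂ (inj₁ refl))
         (λ i<size _ → offset-before [] (Q ∷ []) _ i<size))
      (groupColors-disjoint legal (group blockB) (group blockC) (inj₂ (inj₁ refl))
         (λ i<size _ → offset-before (Q ∷ Q ∷ []) [] _ i<size))
      (λ (z∈C , z∈D) → groupColors-disjoint legal (group blockD) (group blockC) (inj₂ (inj₂ refl))
         (λ i<size _ → offset-before (Q ∷ []) (u ∷ []) _ i<size) (z∈D , z∈C))
      (used blockA) (used blockB) (used blockC) (used blockD) few
    where
    unique : {p : ℕ} (β : Block p) → Unique (groupColors (group β) col)
    unique β = groupColors-unique legal (group β)
    used : {p : ℕ} (β : Block p) → groupColors (group β) col ⊆ usedColors total col
    used β = groupColors-⊆ (group β) col

request-prefix : (m′ Q u w e u′ w′ e′ j : ℕ) → j < Q + Q →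
  Instance.request m′ Q u w e j ≡ Instance.request m′ Q u′ w′ e′ j
request-prefix m′ Q u w e u′ w′ e′ = prepend-agree (λ k k<Q → trans (prepend-head k<Q) (sym (prepend-head k<Q)))

quarter-split : (n : ℕ) → Σ ℕ λ Q → Σ ℕ λ e →
  n ≡ Q + (Q + (n / 4 + (n / 4 + e))) × n / 4 ≤ Q × e ≤ 1
quarter-split n = by-remainder (n % 4) (m%n<n n 4) (m≡m%n+[m/n]*n n 4)
  where
  q : ℕ
  q = n / 4
  by-remainder : (r : ℕ) → r < 4 → n ≡ r + q * 4 → Σ ℕ λ Q → Σ ℕ λ e →
    n ≡ Q + (Q + (q + (q + e))) × q ≤ Q × e ≤ 1
  by-remainder 0 _ n≡ = q , 0 , trans n≡ (r0 q) , ≤-refl , z≤n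
    where r0 : ∀ q → 0 + q * 4 ≡ q + (q + (q + (q + 0)))
          r0 = solve-∀
  by-remainder 1 _ n≡ = q , 1 , trans n≡ (r1 q) , ≤-refl , ≤-refl
    where r1 : ∀ q → 1 + q * 4 ≡ q + (q + (q + (q + 1)))
          r1 = solve-∀
  by-remainder 2 _ n≡ = suc q , 0 , trans n≡ (r2 q) , n≤1+n q , z≤n
    where r2 : ∀ q → 2 + q * 4 ≡ suc q + (suc q + (q + (q + 0)))
          r2 = solve-∀
  by-remainder 3 _ n≡ = suc q , 1 , trans n≡ (r3 q) , n≤1+n q , ≤-refl
    where r3 : ∀ q → 3 + q * 4 ≡ suc q + (suc q + (q + (q + 1)))
          r3 = solve-∀
  by-remainder (suc (suc (suc (suc _)))) (s≤s (s≤s (s≤s (s≤s ())))) _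

-- Splitting the q requests at each inner node as u + (q ∸ u).
total-split : (m′ Q q u e : ℕ) → u ≤ q → Q + (Q + (q + (q + e))) ≡ Instance.total m′ Q u (q ∸ u) e
total-split m′ Q q u e u≤q = trans (cong (λ q → Q + (Q + (q + (q + e)))) (sym (m+[n∸m]≡n u≤q))) (regroup Q u (q ∸ u) e)
  where
  regroup : ∀ Q u w e → Q + (Q + ((u + w) + ((u + w) + e))) ≡ Q + (Q + (u + (u + (w + (w + (e + 0))))))
  regroup = solve-∀

-- With n = 2Q + 2q + e as above, the inputs I_u
-- (0 ≤ u ≤ q) of length n share their first 2Q requests.  With its optimal
-- advice for I_u the algorithm leaves exactly u private colors on that common
-- prefix, a number depending only on the first b advice bits.
module HardInstances (m′ n b : ℕ) (alg : OnlineAlg (10 + m′))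
  (legal : AlwaysLegal n alg) (few-bits : AdviceAtMost n b alg) (optimal : Strict1Competitive n alg)
  (q Q e : ℕ) (n≡ : n ≡ Q + (Q + (q + (q + e)))) (q≤Q : q ≤ Q) (e≤1 : e ≤ 1) (1≤q : 1 ≤ q) where

  input : ℕ → Vec (Fin (10 + m′)) n
  input u = tabulateℕ n (Instance.request m′ Q u (q ∸ u) e)

  advice : ℕ → Tape
  advice u = proj₁ (optimal (input u))

  privateCount : Tape → ℕ
  privateCount ψ = length (privateColors Q (onlineColoring alg ψ (input 0)))

  2Q≤n : Q + Q ≤ n
  2Q≤n = subst (Q + Q ≤_) (sym n≡) (+-monoʳ-≤ Q (m≤m+n Q _))

  privateCount-local : ∀ ψ χ → ψ ≈[ b ] χ → privateCount ψ ≡ privateCount χ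
  privateCount-local ψ χ ψ≈χ = cong length (privateColors-cong Q _ _ λ j j<2Q →
    onlineColoring-local {alg = alg} few-bits ψ≈χ (input 0) (<-≤-trans j<2Q 2Q≤n))

  -- ... and with the advice for I_u it equals u: the coloring of I_u agrees
  -- with that of I_0 on the prefix, is legal, and uses at most Opt(I_u) ≤ Q + u
  -- colors.
  privateCount-advice : ∀ u → u ≤ q → privateCount (advice u) ≡ u
  privateCount-advice u u≤q = begin
    privateCount (advice u)                ≡⟨ cong length (privateColors-cong Q _ col same-prefix) ⟩
    length (privateColors Q col)           ≡⟨ optimal-private n≡total col legal-col (≤-trans at-most-optimal few-offline) ⟩
    u                                      ∎
    where
    open ≡-Reasoning
    open Instance m′ Q u (q ∸ u) e
    n≡total : n ≡ total
    n≡total = trans n≡ (total-split m′ Q q u e u≤q)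
    col : ℕ → ℕ
    col = onlineColoring alg (advice u) (input u)
    same-prefix : ∀ j → j < Q + Q → onlineColoring alg (advice u) (input 0) j ≡ col j
    same-prefix j j<2Q = onlineColoring-prefix alg (advice u) _ _
      (λ k k≤j → request-prefix m′ Q 0 q e u (q ∸ u) e k (≤-<-trans k≤j j<2Q))
    legal-col : LegalSeq n request col
    legal-col = legal⁻ request col (legal (advice u) (input u))
    offline-legal-n : LegalSeq n request offline
    offline-legal-n = subst (λ k → LegalSeq k request offline) (sym n≡total) (offline-legal (≤-trans u≤q q≤Q))
    at-most-optimal : numColors (tabulateℕ n col) ≤ numColors (tabulateℕ n offline)
    at-most-optimal = proj₂ (optimal (input u)) (tabulateℕ n offline) (legal⁺ request offline offline-legal-n)
    few-offline : numColors (tabulateℕ n offline) ≤ Q + u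
    few-offline = subst (λ k → numColors (tabulateℕ k offline) ≤ Q + u) (sym n≡total)
      (offline-colors (≤-trans (m∸n≤m q u) q≤Q) e≤1 (≤-trans 1≤q q≤Q))

  advice-bound : suc q ≤ 2 ^ b
  advice-bound = few-values b q privateCount advice privateCount-local privateCount-advice

advice-lower-bound : (m′ n b : ℕ) (alg : OnlineAlg (10 + m′)) → AlwaysLegal n alg →
  AdviceAtMost n b alg → Strict1Competitive n alg → suc (n / 4) ≤ 2 ^ b
advice-lower-bound m′ n b alg legal few-bits optimal with n <? 4
... | yes n<4 rewrite m<n⇒m/n≡0 {n} {4} n<4 = m^n>0 2 b
... | no n≮4 with quarter-split n
... | Q , e , n≡ , q≤Q , e≤1 =
  HardInstances.advice-bound m′ n b alg legal few-bits optimal (n / 4) Q e n≡ q≤Q e≤1 (m≥n⇒m/n>0 (≮⇒≥ n≮4))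

theorem1 : (m : ℕ) → 10 ≤ m → (n b : ℕ) (A : OnlineAlg m) →
    AlwaysLegal n A → AdviceAtMost n b A → Strict1Competitive n A →
    ⌈log₂ (n / 4 + 1) ⌉ ≤ b
theorem1 m 10≤m n b with m ∸ 10 | m+[n∸m]≡n 10≤m
... | m′ | refl = λ alg legal few-bits optimal →
  ⌈log₂⌉-≤ b (n / 4 + 1) (subst (_≤ 2 ^ b) (+-comm 1 (n / 4)) (advice-lower-bound m′ n b alg legal few-bits optimal))
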